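{- Let $\mathcal{G}=\langle G_1,\dots,G_L\rangle$ be a non-strict temporal graph on vertex set $V$ in which every layer consists of exactly two components and no two consecutive layers have the same partition. If for some $i$ with $2\le i\le L-1$ the transition from step $i-1$ to step $i$ is free and the transition from step $i$ to step $i+1$ is restricted, then for every $s\in V$ there is a non-strict exploration schedule starting at $s$.
   Context: A non-strict temporal graph is a sequence of partitions $G_t$ of $V$ (components). A non-strict temporal walk starting at $v$ at time $t_1$ is a sequence of components $C_{t_1},C_{t_1+1},\dots,C_{t_l}$ with $C_t\in G_t$, consecutive components intersecting, and $v\in C_{t_1}$; it visits the union of its components. A non-strict exploration schedule starting at $s$ is such a walk with $t_1=1$ starting at $s$ that visits all of $V$. With $G_j=\{A_j,B_j\}$, $G_{j+1}=\{A_{j+1},B_{j+1}\}$, the transition from step $j$ to $j+1$ is free if $A_j\cap A_{j+1}$, $A_j\cap B_{j+1}$, $B_j\cap A_{j+1}$, $B_j\cap B_{j+1}$ are all non-empty, and restricted if exactly one of them is empty. -}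

module Defs where

open import Data.Nat using (ℕ; suc; _≤_; _<_)
open import Data.Fin using (Fin)
open import Data.Bool using (Bool; true; false; not)
open import Data.Product using (Σ; ∃; _×_)
open import Data.Sum using (_⊎_)
open import Relation.Nullary using (¬_)
open import Relation.Binary.PropositionalEquality using (_≡_; _≢_)

-- A layer whose partition has (at most) two parts is
-- encoded by a 2-colouring  Fin n → Bool ; its components are the colour
-- classes  A = {v | c v ≡ true},  B = {v | c v ≡ false}.
-- A temporal graph is  G : ℕ → Fin n → Bool , layers G 1, …, G L (1-based,
-- as in the paper; G 0 and G t for t > L are irrelevant).
TGraph : ℕ → Set
TGraph n = ℕ → Fin n → Bool

Comp : ∀ {n} → TGraph n → ℕ → Bool → Fin n → Set
Comp G t b v = G t v ≡ b

TwoComponents : ∀ {n} → TGraph n → ℕ → Set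
TwoComponents G t = (∃ λ v → Comp G t true v) × (∃ λ v → Comp G t false v)

SamePartition : ∀ {n} → TGraph n → ℕ → ℕ → Set
SamePartition G t u = (∀ v → G t v ≡ G u v) ⊎ (∀ v → G t v ≡ not (G u v))

Meets : ∀ {n} → TGraph n → ℕ → Bool → Bool → Set
Meets G j a b = ∃ λ v → Comp G j a v × Comp G (suc j) b v

Free : ∀ {n} → TGraph n → ℕ → Set
Free G j = ∀ a b → Meets G j a b

Restricted : ∀ {n} → TGraph n → ℕ → Set
Restricted G j =
  Σ Bool λ a → Σ Bool λ b →
    ¬ Meets G j a b × (∀ a' b' → (a' ≢ a ⊎ b' ≢ b) → Meets G j a' b')

record ExplorationSchedule {n} (G : TGraph n) (L : ℕ) (s : Fin n) : Set where
  field
    l       : ℕ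
    1≤l     : 1 ≤ l
    l≤L     : l ≤ L
    c       : ℕ → Bool
    start   : Comp G 1 (c 1) s
    linked  : ∀ t → 1 ≤ t → t < l → Meets G t (c t) (c (suc t))
    covers  : ∀ v → ∃ λ t → 1 ≤ t × t ≤ l × Comp G t (c t) v

-- Follow the component of s up to step i − 1.  Since the transition into step
-- i is free, the walk may then enter the component ¬a of step i, where (a, b)
-- is the unique empty intersection of the restricted transition; (¬a, ¬b) is a
-- different pair, so the walk continues into ¬b at step i + 1.  A vertex
-- outside ¬a at step i and outside ¬b at step i + 1 would lie in a ∩ b, which
-- is empty, so these two components already cover V.
module Submission where

open import Defs
open import Data.Nat using (ℕ; zero; suc; _≤_; _<_; _∸_; z≤n; s≤s; _≤?_)
open import Data.Nat.Properties using (≤-refl; <⇒≤; n≤1+n; 1+n≰n; m<1+n⇒m<n∨m≡n)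
open import Data.Fin using (Fin)
open import Data.Bool using (Bool; not; if_then_else_) renaming (_≟_ to _≟ᵇ_)
open import Data.Bool.Properties using (not-¬; ¬-not)
open import Data.Product using (_,_)
open import Data.Sum using (_⊎_; inj₁; inj₂; [_,_])
open import Data.Empty using (⊥-elim)
open import Relation.Nullary using (¬_; does; yes; no)
open import Relation.Nullary.Decidable using (dec-true; dec-false)
open import Relation.Binary.PropositionalEquality using (_≡_; refl; sym; trans; subst₂)

m≤n∸1⇒m<n : ∀ {m} n → 1 ≤ m → m ≤ n ∸ 1 → m < n
m≤n∸1⇒m<n zero    (s≤s _) ()
m≤n∸1⇒m<n (suc n) _       m≤n = s≤s m≤n

module _ {n} (G : TGraph n) {j : ℕ} {a b : Bool} where

  complements-cover : ¬ Meets G j a b →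
                      ∀ v → Comp G j (not a) v ⊎ Comp G (suc j) (not b) v
  complements-cover a∩b≡∅ v with G j v ≟ᵇ a | G (suc j) v ≟ᵇ b
  ... | no v∉a  | _       = inj₁ (¬-not v∉a)
  ... | yes _   | no v∉b  = inj₂ (¬-not v∉b)
  ... | yes v∈a | yes v∈b = ⊥-elim (a∩b≡∅ (v , v∈a , v∈b))

module _ {n} (G : TGraph n) (s : Fin n) (j : ℕ) (x y : Bool) where

  detour : ℕ → Bool
  detour t = if does (t ≤? j) then G t s else if does (t ≤? suc j) then x else y

  detour-≤ : ∀ {t} → t ≤ j → detour t ≡ G t s
  detour-≤ t≤j rewrite dec-true (_ ≤? j) t≤j = refl

  detour-suc : detour (suc j) ≡ x
  detour-suc rewrite dec-false (suc j ≤? j) 1+n≰n | dec-true (suc j ≤? suc j) ≤-refl = refl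

  detour-suc-suc : detour (suc (suc j)) ≡ y
  detour-suc-suc
    rewrite dec-false (suc (suc j) ≤? j) (λ p → 1+n≰n (<⇒≤ p))
          | dec-false (suc (suc j) ≤? suc j) 1+n≰n = refl

  detour-linked : Meets G j (G j s) x → Meets G (suc j) x y →
                  ∀ t → t < suc (suc j) → Meets G t (detour t) (detour (suc t))
  detour-linked j→x x→y t t<j+2 with m<1+n⇒m<n∨m≡n t<j+2
  ... | inj₂ refl = subst₂ (Meets G t) (sym detour-suc) (sym detour-suc-suc) x→y
  ... | inj₁ t<j+1 with m<1+n⇒m<n∨m≡n t<j+1
  ...   | inj₂ refl = subst₂ (Meets G t) (sym (detour-≤ ≤-refl)) (sym detour-suc) j→x
  ...   | inj₁ t<j  = s , sym (detour-≤ (<⇒≤ t<j)) , sym (detour-≤ t<j)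

  detour-schedule : ∀ {L} → 1 ≤ j → suc (suc j) ≤ L →
                    Meets G j (G j s) x → Meets G (suc j) x y →
                    (∀ v → Comp G (suc j) x v ⊎ Comp G (suc (suc j)) y v) →
                    ExplorationSchedule G L s
  detour-schedule 1≤j j+2≤L j→x x→y x∪y≡V = record
    { l      = suc (suc j)
    ; 1≤l    = s≤s z≤n
    ; l≤L    = j+2≤L
    ; c      = detour
    ; start  = sym (detour-≤ 1≤j)
    ; linked = λ t _ → detour-linked j→x x→y t
    ; covers = λ v → [ (λ v∈x → suc j , s≤s z≤n , n≤1+n _ , trans v∈x (sym detour-suc))
                     , (λ v∈y → suc (suc j) , s≤s z≤n , ≤-refl , trans v∈y (sym detour-suc-suc))
                     ] (x∪y≡V v)
    }

lemma26 : (n L : ℕ) (G : TGraph n)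
    → (∀ t → 1 ≤ t → t ≤ L → TwoComponents G t)
    → (∀ t → 1 ≤ t → t < L → ¬ SamePartition G t (suc t))
    → (i : ℕ) → 2 ≤ i → i ≤ L ∸ 1
    → Free G (i ∸ 1) → Restricted G i
    → (s : Fin n) → ExplorationSchedule G L s
lemma26 n L G _ _ (suc j) (s≤s 1≤j) i≤L-1 free (a , b , a∩b≡∅ , others-meet) s =
  detour-schedule G s j (not a) (not b) 1≤j (m≤n∸1⇒m<n L (s≤s z≤n) i≤L-1)
    (free (G j s) (not a))
    (others-meet (not a) (not b) (inj₁ (λ ¬a≡a → not-¬ refl (sym ¬a≡a))))
    (complements-cover G a∩b≡∅)
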